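{- Let $H=(V,E,\ell)$ be an edge-colored hypergraph with colors $[k]$ and let $b\ge 0$ be an integer. Let $\{x_v^c, x_e, y_v\}$ be an optimal solution of the linear program $$\min \sum_{e\in E} x_e \quad\text{s.t.}\quad \sum_{c=1}^k x_v^c\ge k-y_v-1\ \ \forall v\in V;\qquad \sum_{v\in V} y_v\le b;\qquad x_v^c\le x_e\ \ \forall c\in[k],\ \forall e\in E\text{ with }\ell(e)=c,\ \forall v\in e;$$ $$x_v^c,x_e\in[0,1]\ \ \forall c,v,e;\qquad y_v\ge 0\ \ \forall v\in V.$$ For $\delta\in(0,1)$ and $x\ge 0$ define $\lfloor x\rceil_\delta=\lfloor x\rfloor$ if $x-\lfloor x\rfloor<\delta$ and $\lfloor x\rceil_\delta=\lceil x\rceil$ otherwise. Fix $\delta\in(0,1)$, let $\rho_v=\frac{1-\delta}{\lfloor y_v\rceil_\delta+2}$ for each $v\in V$, and let $\lambda$ be the coloring that assigns color $c$ to node $v$ if and only if $x_v^c<\rho_v$. Then $\lambda$ is a bicriteria $\left(\frac{b+2}{1-\delta}+1,\ \frac1\delta\right)$-approximation for Global Overlapping ECC: its number of mistakes is at most $\left(\frac{b+2}{1-\delta}+1\right)$ times the optimal number of mistakes for Global Overlapping ECC with budget $b$, and the number of additional color assignments (beyond one per node) is at most $b/\delta$.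
   Context: An edge-colored hypergraph $H=(V,E,\ell)$ consists of a finite node set $V$, a finite collection $E$ of hyperedges (subsets of $V$), and a labeling $\ell:E\to[k]$. A coloring is a map $\lambda:V\to 2^{[k]}$; it makes a mistake at $e\in E$ if some $v\in e$ has $\ell(e)\notin\lambda(v)$. Global Overlapping ECC with budget $b\ge0$: minimize the number of hyperedges at which $\lambda$ makes a mistake over colorings with $|\lambda(v)|\ge1$ for all $v$ and $\sum_{v\in V}(|\lambda(v)|-1)\le b$ (each node gets one free color and $b$ extra color assignments are shared among all nodes). A bicriteria $(\alpha,\beta)$-approximation is a coloring whose number of mistakes is within a factor $\alpha$ of the optimum and which violates the budget constraint by a factor at most $\beta$.
   Formalization: The optimal LP solution $\{x_v^c, x_e, y_v\}$ and the threshold δ take rational values, with optimality of the LP solution required only against rational feasible solutions. -}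

module Defs where

open import Data.Nat as ℕ using (ℕ; zero; suc; _∸_)
open import Data.Integer as ℤ using (ℤ)
open import Data.Rational as ℚ using (ℚ; 0ℚ; 1ℚ; _+_; _-_; _*_; _÷_; _<_; _≤_; floor; ceiling; positive)
open import Data.Rational.Properties using (pos⇒nonZero; _<?_)
open import Data.Fin using (Fin; zero; suc)
open import Data.Fin.Properties using (any?)
open import Data.Fin.Subset using (Subset; _∈_; _∉_; ∣_∣)
open import Data.Fin.Subset.Properties using (_∈?_)
open import Data.Vec using (tabulate)
open import Data.Product using (∃; _×_; _,_)
open import Data.Bool using (if_then_else_)
open import Relation.Nullary using (does; ¬?)
open import Relation.Nullary.Decidable using (_×-dec_)
open import Relation.Binary.PropositionalEquality using (_≡_)

ℕ→ℚ : ℕ → ℚ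
ℕ→ℚ n = ℤ.+ n ℚ./ 1

ℤ→ℚ : ℤ → ℚ
ℤ→ℚ z = z ℚ./ 1

divPos : (p q : ℚ) → 0ℚ < q → ℚ
divPos p q h = _÷_ p q {{pos⇒nonZero q {{positive h}}}}

sumℕ : ∀ {n} → (Fin n → ℕ) → ℕ
sumℕ {zero}  f = 0
sumℕ {suc n} f = f zero ℕ.+ sumℕ (λ i → f (suc i))

sumℚ : ∀ {n} → (Fin n → ℚ) → ℚ
sumℚ {zero}  f = 0ℚ
sumℚ {suc n} f = f zero + sumℚ (λ i → f (suc i))

record Hypergraph (k : ℕ) : Set where
  field
    n : ℕ
    m : ℕ
    E : Fin m → Subset n
    ℓ : Fin m → Fin k
open Hypergraph public

Coloring : ∀ {k} → Hypergraph k → Set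
Coloring {k} H = Fin (n H) → Subset k

Mistake : ∀ {k} (H : Hypergraph k) → Coloring H → Fin (m H) → Set
Mistake H col e = ∃ λ v → v ∈ E H e × ℓ H e ∉ col v

mistakes : ∀ {k} (H : Hypergraph k) → Coloring H → ℕ
mistakes H col = sumℕ (λ e →
  if does (any? (λ v → (v ∈? E H e) ×-dec ¬? (ℓ H e ∈? col v))) then 1 else 0)

extraColors : ∀ {k} (H : Hypergraph k) → Coloring H → ℕ
extraColors H col = sumℕ (λ v → ∣ col v ∣ ∸ 1)

FeasibleGOECC : ∀ {k} (H : Hypergraph k) → ℕ → Coloring H → Set
FeasibleGOECC H b col = (∀ v → 1 ℕ.≤ ∣ col v ∣) × (extraColors H col ℕ.≤ b)

record LPSol {k} (H : Hypergraph k) : Set where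
  field
    x  : Fin (n H) → Fin k → ℚ
    xe : Fin (m H) → ℚ
    y  : Fin (n H) → ℚ
open LPSol public

LPObjective : ∀ {k} {H : Hypergraph k} → LPSol H → ℚ
LPObjective s = sumℚ (xe s)

LPFeasible : ∀ {k} (H : Hypergraph k) → ℕ → LPSol H → Set
LPFeasible {k} H b s =
    (∀ v → ℕ→ℚ k - y s v - 1ℚ ≤ sumℚ (λ c → x s v c))
  × (sumℚ (y s) ≤ ℕ→ℚ b)
  × (∀ c e v → ℓ H e ≡ c → v ∈ E H e → x s v c ≤ xe s e)
  × (∀ v c → 0ℚ ≤ x s v c × x s v c ≤ 1ℚ)
  × (∀ e → 0ℚ ≤ xe s e × xe s e ≤ 1ℚ)
  × (∀ v → 0ℚ ≤ y s v)

LPOptimal : ∀ {k} (H : Hypergraph k) → ℕ → LPSol H → Set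
LPOptimal H b s =
  LPFeasible H b s × (∀ s' → LPFeasible H b s' → LPObjective s ≤ LPObjective s')

roundδ : ℚ → ℚ → ℤ
roundδ δ x = if does (x - ℤ→ℚ (floor x) <? δ) then floor x else ceiling x

-- ρ_v = (1 - δ) / (⌊y_v⌉_δ + 2)   (⌊y_v⌉_δ ≥ 0 since y_v ≥ 0)
ρ : ℚ → ℚ → ℚ
ρ δ yv = (1ℚ - δ) * (ℤ.+ 1 ℚ./ suc (suc (ℤ.∣ roundδ δ yv ∣)))

roundedColoring : ∀ {k} {H : Hypergraph k} → ℚ → LPSol H → Coloring H
roundedColoring δ s v = tabulate (λ c → does (x s v c <? ρ δ (y s v)))

-- With r_v = ⌊y_v⌉_δ one has r_v δ ≤ y_v < r_v + δ and r_v < y_v + 1, hence r_v ≤ b.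
-- If r_v + 2 colors had x_v^c < ρ_v, the covering constraint Σ_c x_v^c ≥ k − y_v − 1
-- would give (r_v + 2)(1 − ρ_v) = r_v + 1 + δ ≤ y_v + 1; so node v gets at most r_v ≤ y_v/δ
-- extra colors, and in total at most b/δ. A mistake at e comes from some v ∈ e with
-- x_v^ℓ(e) ≥ ρ_v ≥ (1 − δ)/(b + 2), so x_e ≥ (1 − δ)/(b + 2) and the number of mistakes
-- is at most (b + 2)/(1 − δ) times the LP optimum. Finally every feasible coloring induces
-- a feasible LP solution whose objective is its own number of mistakes.
module Submission where

open import Data.Bool using (if_then_else_)
open import Level using (0ℓ)
open import Data.Empty using (⊥-elim)
open import Data.Fin using (Fin; zero; suc)
open import Data.Fin.Properties using (any?)
open import Data.Fin.Subset using (Subset; _∈_; _∉_; ∣_∣; inside; outside)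
open import Data.Fin.Subset.Properties using (_∈?_)
open import Data.Integer as ℤ using (ℤ; +_; -[1+_]; +≤+)
import Data.Integer.DivMod as ℤ
import Data.Integer.Properties as ℤP
open import Data.Nat as ℕ using (ℕ; zero; suc; _∸_)
import Data.Nat.Coprimality as Coprime
import Data.Nat.Properties as ℕP
open import Data.Product using (_×_; _,_; proj₁; proj₂)
open import Data.Rational as ℚ
  using (ℚ; mkℚ; 0ℚ; 1ℚ; _+_; _-_; _*_; -_; 1/_; _<_; _≤_; *≤*; *<*; floor; ceiling)
import Data.Rational.Properties as ℚP
open import Algebra.Properties.Group ℚP.+-0-group using () renaming (⁻¹-involutive to neg-involutive)
open import Data.Vec using (tabulate; _∷_; [])
open import Data.Vec.Properties using (lookup∘tabulate; lookup⇒[]=)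
open import Relation.Binary.PropositionalEquality
open import Relation.Nullary using (Dec; yes; no; does; ¬?)
open import Relation.Nullary.Decidable using (dec⇒maybe; dec-true; _×-dec_)
open import Tactic.RingSolver using (solve-∀)
open import Tactic.RingSolver.Core.AlmostCommutativeRing
  using (AlmostCommutativeRing; fromCommutativeRing)
open import Defs

ℚ-ring : AlmostCommutativeRing 0ℓ 0ℓ
ℚ-ring = fromCommutativeRing ℚP.+-*-commutativeRing (λ p → dec⇒maybe (0ℚ ℚP.≟ p))

ℤ→ℚ≡mkℚ : ∀ i → ℤ→ℚ i ≡ mkℚ i 0 (Coprime.sym (Coprime.1-coprimeTo ℤ.∣ i ∣))
ℤ→ℚ≡mkℚ i = ℚP.↥p/↧p≡p (mkℚ i 0 (Coprime.sym (Coprime.1-coprimeTo ℤ.∣ i ∣)))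

ℤ→ℚ-+ : ∀ i j → ℤ→ℚ (i ℤ.+ j) ≡ ℤ→ℚ i + ℤ→ℚ j
ℤ→ℚ-+ i j rewrite ℤ→ℚ≡mkℚ i | ℤ→ℚ≡mkℚ j =
  ℚP./-cong (sym (cong₂ ℤ._+_ (ℤP.*-identityʳ i) (ℤP.*-identityʳ j))) refl

ℤ→ℚ-neg : ∀ i → ℤ→ℚ (ℤ.- i) ≡ - ℤ→ℚ i
ℤ→ℚ-neg (+ zero)  = refl
ℤ→ℚ-neg (+ suc n) = refl
ℤ→ℚ-neg -[1+ n ]  rewrite ℤ→ℚ≡mkℚ (+ suc n) = refl

ℤ→ℚ-mono-≤ : ∀ {i j} → i ℤ.≤ j → ℤ→ℚ i ≤ ℤ→ℚ j
ℤ→ℚ-mono-≤ {i} {j} i≤j rewrite ℤ→ℚ≡mkℚ i | ℤ→ℚ≡mkℚ j =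
  *≤* (subst₂ ℤ._≤_ (sym (ℤP.*-identityʳ i)) (sym (ℤP.*-identityʳ j)) i≤j)

ℤ→ℚ-cancel-≤ : ∀ {i j} → ℤ→ℚ i ≤ ℤ→ℚ j → i ℤ.≤ j
ℤ→ℚ-cancel-≤ {i} {j} i≤j rewrite ℤ→ℚ≡mkℚ i | ℤ→ℚ≡mkℚ j with i≤j
... | *≤* i*1≤j*1 = subst₂ ℤ._≤_ (ℤP.*-identityʳ i) (ℤP.*-identityʳ j) i*1≤j*1

ℤ→ℚ-cancel-< : ∀ {i j} → ℤ→ℚ i < ℤ→ℚ j → i ℤ.< j
ℤ→ℚ-cancel-< {i} {j} i<j rewrite ℤ→ℚ≡mkℚ i | ℤ→ℚ≡mkℚ j with i<j
... | *<* i*1<j*1 = subst₂ ℤ._<_ (ℤP.*-identityʳ i) (ℤP.*-identityʳ j) i*1<j*1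

ℤ→ℚ-<1+⇒≤ : ∀ {i j} → ℤ→ℚ i < 1ℚ + ℤ→ℚ j → i ℤ.≤ j
ℤ→ℚ-<1+⇒≤ {i} {j} i<1+j =
  subst (i ℤ.≤_) (ℤP.pred-suc j)
    (ℤP.i<j⇒i≤pred[j] (ℤ→ℚ-cancel-< {i} {ℤ.suc j} (subst (ℤ→ℚ i <_) (sym (ℤ→ℚ-+ (+ 1) j)) i<1+j)))

ℕ→ℚ-+ : ∀ m n → ℕ→ℚ (m ℕ.+ n) ≡ ℕ→ℚ m + ℕ→ℚ n
ℕ→ℚ-+ m n = ℤ→ℚ-+ (+ m) (+ n)

ℕ→ℚ-suc : ∀ n → ℕ→ℚ (suc n) ≡ 1ℚ + ℕ→ℚ n
ℕ→ℚ-suc n = ℕ→ℚ-+ 1 n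

ℕ→ℚ-mono-≤ : ∀ {m n} → m ℕ.≤ n → ℕ→ℚ m ≤ ℕ→ℚ n
ℕ→ℚ-mono-≤ m≤n = ℤ→ℚ-mono-≤ (+≤+ m≤n)

ℕ→ℚ-nonNeg : ∀ n → 0ℚ ≤ ℕ→ℚ n
ℕ→ℚ-nonNeg n = ℕ→ℚ-mono-≤ (ℕ.z≤n {n})

1/suc : ℕ → ℚ
1/suc n = + 1 ℚ./ suc n

1/suc≡mkℚ : ∀ n → 1/suc n ≡ mkℚ (+ 1) n (Coprime.1-coprimeTo (suc n))
1/suc≡mkℚ n = ℚP.↥p/↧p≡p (mkℚ (+ 1) n (Coprime.1-coprimeTo (suc n)))

ℕ→ℚ-suc*1/suc : ∀ n → ℕ→ℚ (suc n) * 1/suc n ≡ 1ℚ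
ℕ→ℚ-suc*1/suc n rewrite 1/suc≡mkℚ n | ℤ→ℚ≡mkℚ (+ suc n) =
  ℚP.*-inverseʳ (mkℚ (+ suc n) 0 (Coprime.sym (Coprime.1-coprimeTo (suc n))))

1/suc-antimono : ∀ {m n} → m ℕ.≤ n → 1/suc n ≤ 1/suc m
1/suc-antimono {m} {n} m≤n rewrite 1/suc≡mkℚ m | 1/suc≡mkℚ n =
  *≤* (subst₂ ℤ._≤_ (sym (ℤP.*-identityˡ (+ suc m))) (sym (ℤP.*-identityˡ (+ suc n))) (+≤+ (ℕ.s≤s m≤n)))

p<p+q : ∀ {p q} → 0ℚ < q → p < p + q
p<p+q {p} {q} 0<q = subst (_< p + q) (ℚP.+-identityʳ p) (ℚP.+-monoʳ-< p 0<q)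

p<1+p : ∀ p → p < 1ℚ + p
p<1+p p = subst (p <_) (ℚP.+-comm p 1ℚ) (p<p+q (ℚP.positive⁻¹ 1ℚ))

p≤p+q : ∀ {p q} → 0ℚ ≤ q → p ≤ p + q
p≤p+q {p} {q} 0≤q = subst (_≤ p + q) (ℚP.+-identityʳ p) (ℚP.+-monoʳ-≤ p 0≤q)

p≤q+p : ∀ {p q} → 0ℚ ≤ q → p ≤ q + p
p≤q+p {p} {q} 0≤q = subst (p ≤_) (ℚP.+-comm p q) (p≤p+q 0≤q)

p-q≤p : ∀ {p q} → 0ℚ ≤ q → p - q ≤ p
p-q≤p {p} {q} 0≤q = subst (p - q ≤_) (ℚP.+-identityʳ p) (ℚP.+-monoʳ-≤ p (ℚP.neg-antimono-≤ 0≤q))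

p≤q⇒0≤q-p : ∀ {p q} → p ≤ q → 0ℚ ≤ q - p
p≤q⇒0≤q-p {p} {q} p≤q = subst (_≤ q - p) (ℚP.+-inverseʳ p) (ℚP.+-monoˡ-≤ (- p) p≤q)

p-q+q≡p : ∀ p q → p - q + q ≡ p
p-q+q≡p = solve-∀ ℚ-ring

p*q≤p : ∀ {p q} → 0ℚ ≤ p → q ≤ 1ℚ → p * q ≤ p
p*q≤p {p} {q} 0≤p q≤1 =
  subst (p * q ≤_) (ℚP.*-identityʳ p) (ℚP.*-monoˡ-≤-nonNeg p {{ℚ.nonNegative 0≤p}} q≤1)

p*q≤[q+1]*p : ∀ {p} q → 0ℚ ≤ p → p * q ≤ (q + 1ℚ) * p
p*q≤[q+1]*p {p} q 0≤p = subst (p * q ≤_) (expand p q) (p≤p+q 0≤p)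
  where
  expand : ∀ a c → a * c + a ≡ (c + 1ℚ) * a
  expand = solve-∀ ℚ-ring

p*q≤r⇒p≤r*t : ∀ {p q r t} → q * t ≡ 1ℚ → 0ℚ ≤ t → p * q ≤ r → p ≤ r * t
p*q≤r⇒p≤r*t {p} {q} {r} {t} q*t≡1 0≤t p*q≤r = begin
  p            ≡⟨ ℚP.*-identityʳ p ⟨
  p * 1ℚ       ≡⟨ cong (p *_) q*t≡1 ⟨
  p * (q * t)  ≡⟨ ℚP.*-assoc p q t ⟨
  p * q * t    ≤⟨ ℚP.*-monoʳ-≤-nonNeg t {{ℚ.nonNegative 0≤t}} p*q≤r ⟩
  r * t        ∎
  where open ℚP.≤-Reasoning

-- Floor, ceiling and δ-rounding

⌊p⌋≤p : ∀ p → ℤ→ℚ (floor p) ≤ p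
⌊p⌋≤p p@(mkℚ n d _) rewrite ℤ→ℚ≡mkℚ (floor p) =
  *≤* (subst (floor p ℤ.* + suc d ℤ.≤_) (sym (ℤP.*-identityʳ n)) (ℤ.[n/d]*d≤n n (+ suc d)))

p<1+⌊p⌋ : ∀ p → p < 1ℚ + ℤ→ℚ (floor p)
p<1+⌊p⌋ p@(mkℚ n d _) = subst (p <_) (ℤ→ℚ-+ (+ 1) (floor p)) p<suc⌊p⌋
  where
  p<suc⌊p⌋ : p < ℤ→ℚ (ℤ.suc (floor p))
  p<suc⌊p⌋ rewrite ℤ→ℚ≡mkℚ (ℤ.suc (floor p)) =
    *<* (subst₂ (λ a q → a ℤ.< ℤ.suc q ℤ.* + suc d) (sym (ℤP.*-identityʳ n))
           (sym (ℤ.div-pos-is-/ℕ n (suc d))) (ℤ.n<s[n/ℕd]*d n (suc d)))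

0≤⌊p⌋ : ∀ {p} → 0ℚ ≤ p → + 0 ℤ.≤ floor p
0≤⌊p⌋ {p} 0≤p = ℤ→ℚ-<1+⇒≤ (ℚP.≤-<-trans 0≤p (p<1+⌊p⌋ p))

p≤⌈p⌉ : ∀ p → p ≤ ℤ→ℚ (ceiling p)
p≤⌈p⌉ p@(mkℚ _ _ _) = begin
  p                    ≡⟨ neg-involutive p ⟨
  - (- p)              ≤⟨ ℚP.neg-antimono-≤ (⌊p⌋≤p (- p)) ⟩
  - ℤ→ℚ (floor (- p))  ≡⟨ ℤ→ℚ-neg (floor (- p)) ⟨
  ℤ→ℚ (ceiling p)      ∎
  where open ℚP.≤-Reasoning

⌈p⌉<1+p : ∀ p → ℤ→ℚ (ceiling p) < 1ℚ + p
⌈p⌉<1+p p@(mkℚ _ _ _) = begin-strict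
  ℤ→ℚ (ceiling p)     ≡⟨ ℤ→ℚ-neg (floor (- p)) ⟩
  - ⌊-p⌋              ≡⟨ shift ⌊-p⌋ ⟩
  1ℚ + - (1ℚ + ⌊-p⌋)  <⟨ ℚP.+-monoʳ-< 1ℚ (ℚP.neg-antimono-< (p<1+⌊p⌋ (- p))) ⟩
  1ℚ + - (- p)        ≡⟨ cong (_+_ 1ℚ) (neg-involutive p) ⟩
  1ℚ + p              ∎
  where
  open ℚP.≤-Reasoning
  ⌊-p⌋ = ℤ→ℚ (floor (- p))
  shift : ∀ a → - a ≡ 1ℚ + - (1ℚ + a)
  shift = solve-∀ ℚ-ring

record RoundδBounds (δ y : ℚ) (r : ℕ) : Set where
  field
    y<r+δ : y < ℕ→ℚ r + δ
    r*δ≤y : ℕ→ℚ r * δ ≤ y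
    r<1+y : ℕ→ℚ r < 1ℚ + y

  r≤ : ∀ {b} → y ≤ ℕ→ℚ b → r ℕ.≤ b
  r≤ {b} y≤b with ℤ→ℚ-<1+⇒≤ {+ r} {+ b} (ℚP.<-≤-trans r<1+y (ℚP.+-monoʳ-≤ 1ℚ y≤b))
  ... | +≤+ r≤b = r≤b

nonNeg-roundδBounds : ∀ {δ y z} → + 0 ℤ.≤ z →
  y < ℤ→ℚ z + δ → ℤ→ℚ z * δ ≤ y → ℤ→ℚ z < 1ℚ + y → RoundδBounds δ y ℤ.∣ z ∣
nonNeg-roundδBounds (+≤+ _) y<z+δ z*δ≤y z<1+y =
  record { y<r+δ = y<z+δ ; r*δ≤y = z*δ≤y ; r<1+y = z<1+y }

module _ {δ y : ℚ} (0<δ : 0ℚ < δ) (δ≤1 : δ ≤ 1ℚ) (0≤y : 0ℚ ≤ y) where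

  private
    ⌊y⌋ ⌈y⌉ : ℚ
    ⌊y⌋ = ℤ→ℚ (floor y)
    ⌈y⌉ = ℤ→ℚ (ceiling y)

    ⌊y⌋*δ≤⌊y⌋ : ⌊y⌋ * δ ≤ ⌊y⌋
    ⌊y⌋*δ≤⌊y⌋ = p*q≤p (ℤ→ℚ-mono-≤ (0≤⌊p⌋ 0≤y)) δ≤1

  roundδ-floor-bounds : y - ⌊y⌋ < δ → RoundδBounds δ y ℤ.∣ floor y ∣
  roundδ-floor-bounds frac<δ = nonNeg-roundδBounds (0≤⌊p⌋ 0≤y) y<⌊y⌋+δ
    (ℚP.≤-trans ⌊y⌋*δ≤⌊y⌋ (⌊p⌋≤p y)) (ℚP.≤-<-trans (⌊p⌋≤p y) (p<1+p y))
    where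
    y<⌊y⌋+δ : y < ⌊y⌋ + δ
    y<⌊y⌋+δ = subst₂ _<_ (p-q+q≡p y ⌊y⌋) (ℚP.+-comm δ ⌊y⌋) (ℚP.+-monoˡ-< ⌊y⌋ frac<δ)

  roundδ-ceiling-bounds : δ ≤ y - ⌊y⌋ → RoundδBounds δ y ℤ.∣ ceiling y ∣
  roundδ-ceiling-bounds δ≤frac = nonNeg-roundδBounds 0≤⌈y⌉
    (ℚP.≤-<-trans (p≤⌈p⌉ y) (p<p+q 0<δ)) ⌈y⌉*δ≤y (⌈p⌉<1+p y)
    where
    open ℚP.≤-Reasoning
    0≤⌈y⌉ : + 0 ℤ.≤ ceiling y
    0≤⌈y⌉ = ℤ→ℚ-cancel-≤ (ℚP.≤-trans 0≤y (p≤⌈p⌉ y))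
    ⌈y⌉<1+suc⌊y⌋ : ⌈y⌉ < 1ℚ + ℤ→ℚ (ℤ.suc (floor y))
    ⌈y⌉<1+suc⌊y⌋ = begin-strict
      ⌈y⌉                          <⟨ ⌈p⌉<1+p y ⟩
      1ℚ + y                       <⟨ ℚP.+-monoʳ-< 1ℚ (p<1+⌊p⌋ y) ⟩
      1ℚ + (1ℚ + ⌊y⌋)              ≡⟨ cong (_+_ 1ℚ) (ℤ→ℚ-+ (+ 1) (floor y)) ⟨
      1ℚ + ℤ→ℚ (ℤ.suc (floor y))  ∎
    ⌈y⌉≤1+⌊y⌋ : ⌈y⌉ ≤ 1ℚ + ⌊y⌋
    ⌈y⌉≤1+⌊y⌋ = subst (⌈y⌉ ≤_) (ℤ→ℚ-+ (+ 1) (floor y)) (ℤ→ℚ-mono-≤ (ℤ→ℚ-<1+⇒≤ {ceiling y} {ℤ.suc (floor y)} ⌈y⌉<1+suc⌊y⌋))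
    ⌈y⌉*δ≤y : ⌈y⌉ * δ ≤ y
    ⌈y⌉*δ≤y = begin
      ⌈y⌉ * δ           ≤⟨ ℚP.*-monoʳ-≤-nonNeg δ {{ℚ.nonNegative (ℚP.<⇒≤ 0<δ)}} ⌈y⌉≤1+⌊y⌋ ⟩
      (1ℚ + ⌊y⌋) * δ    ≡⟨ ℚP.*-distribʳ-+ δ 1ℚ ⌊y⌋ ⟩
      1ℚ * δ + ⌊y⌋ * δ  ≤⟨ ℚP.+-mono-≤ (ℚP.≤-reflexive (ℚP.*-identityˡ δ)) ⌊y⌋*δ≤⌊y⌋ ⟩
      δ + ⌊y⌋           ≤⟨ ℚP.+-monoˡ-≤ ⌊y⌋ δ≤frac ⟩
      y - ⌊y⌋ + ⌊y⌋     ≡⟨ p-q+q≡p y ⌊y⌋ ⟩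
      y                 ∎

  roundδ-bounds : RoundδBounds δ y ℤ.∣ roundδ δ y ∣
  roundδ-bounds = by-cases (y - ⌊y⌋ ℚP.<? δ)
    where
    by-cases : (frac<?δ : Dec (y - ⌊y⌋ < δ)) →
               RoundδBounds δ y ℤ.∣ (if does frac<?δ then floor y else ceiling y) ∣
    by-cases (yes frac<δ) = roundδ-floor-bounds frac<δ
    by-cases (no frac≮δ)  = roundδ-ceiling-bounds (ℚP.≮⇒≥ frac≮δ)

ℕ→ℚ-sumℕ : ∀ {n} (f : Fin n → ℕ) → ℕ→ℚ (sumℕ f) ≡ sumℚ (λ i → ℕ→ℚ (f i))
ℕ→ℚ-sumℕ {zero}  f = refl
ℕ→ℚ-sumℕ {suc n} f =
  trans (ℕ→ℚ-+ (f zero) _) (cong (_+_ (ℕ→ℚ (f zero))) (ℕ→ℚ-sumℕ (λ i → f (suc i))))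

sumℚ-*ʳ : ∀ {n} (f : Fin n → ℚ) p → sumℚ (λ i → f i * p) ≡ sumℚ f * p
sumℚ-*ʳ {zero}  f p = sym (ℚP.*-zeroˡ p)
sumℚ-*ʳ {suc n} f p = trans (cong (_+_ (f zero * p)) (sumℚ-*ʳ (λ i → f (suc i)) p))
                            (sym (ℚP.*-distribʳ-+ p (f zero) _))

sumℚ-mono-≤ : ∀ {n} {f g : Fin n → ℚ} → (∀ i → f i ≤ g i) → sumℚ f ≤ sumℚ g
sumℚ-mono-≤ {zero}  f≤g = ℚP.≤-refl
sumℚ-mono-≤ {suc n} f≤g = ℚP.+-mono-≤ (f≤g zero) (sumℚ-mono-≤ (λ i → f≤g (suc i)))

sumℚ-nonNeg : ∀ {n} {f : Fin n → ℚ} → (∀ i → 0ℚ ≤ f i) → 0ℚ ≤ sumℚ f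
sumℚ-nonNeg {zero}  0≤f = ℚP.≤-refl
sumℚ-nonNeg {suc n} 0≤f = ℚP.+-mono-≤ (0≤f zero) (sumℚ-nonNeg (λ i → 0≤f (suc i)))

f≤sumℚ : ∀ {n} {f : Fin n → ℚ} → (∀ i → 0ℚ ≤ f i) → ∀ i → f i ≤ sumℚ f
f≤sumℚ {suc n} 0≤f zero    = p≤p+q (sumℚ-nonNeg (λ i → 0≤f (suc i)))
f≤sumℚ {suc n} 0≤f (suc i) = ℚP.≤-trans (f≤sumℚ (λ j → 0≤f (suc j)) i) (p≤q+p (0≤f zero))

indicator : ∀ {A : Set} → Dec A → ℕ
indicator A? = if does A? then 1 else 0

indicator≤1 : ∀ {A : Set} (A? : Dec A) → indicator A? ℕ.≤ 1
indicator≤1 (yes _) = ℕ.s≤s ℕ.z≤n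
indicator≤1 (no _)  = ℕ.z≤n

indicator-mono : ∀ {A B : Set} (A? : Dec A) (B? : Dec B) → (A → B) → indicator A? ℕ.≤ indicator B?
indicator-mono (yes a) (yes _) _   = ℕ.s≤s ℕ.z≤n
indicator-mono (yes a) (no ¬b) A→B = ⊥-elim (¬b (A→B a))
indicator-mono (no _)  B?      _   = ℕ.z≤n

ℕ→ℚ-indicator*≤ : ∀ {A : Set} (A? : Dec A) {θ X} → 0ℚ ≤ X → (A → θ ≤ X) →
  ℕ→ℚ (indicator A?) * θ ≤ X
ℕ→ℚ-indicator*≤ (yes a) {θ} _   θ≤X = subst (_≤ _) (sym (ℚP.*-identityˡ θ)) (θ≤X a)
ℕ→ℚ-indicator*≤ (no _)  {θ} 0≤X _   = subst (_≤ _) (sym (ℚP.*-zeroˡ θ)) 0≤X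

count*≤sumℚ : ∀ {n} {P : Fin n → Set} (P? : ∀ i → Dec (P i)) {θ} {X : Fin n → ℚ} →
  (∀ i → 0ℚ ≤ X i) → (∀ i → P i → θ ≤ X i) → ℕ→ℚ (sumℕ (λ i → indicator (P? i))) * θ ≤ sumℚ X
count*≤sumℚ P? {θ} {X} 0≤X θ≤X = begin
  ℕ→ℚ (sumℕ 𝟙) * θ            ≡⟨ cong (_* θ) (ℕ→ℚ-sumℕ 𝟙) ⟩
  sumℚ (λ i → ℕ→ℚ (𝟙 i)) * θ  ≡⟨ sumℚ-*ʳ (λ i → ℕ→ℚ (𝟙 i)) θ ⟨
  sumℚ (λ i → ℕ→ℚ (𝟙 i) * θ)  ≤⟨ sumℚ-mono-≤ (λ i → ℕ→ℚ-indicator*≤ (P? i) (0≤X i) (θ≤X i)) ⟩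
  sumℚ X                      ∎
  where
  open ℚP.≤-Reasoning
  𝟙 = λ i → indicator (P? i)

-- Colors below a threshold

-- roundedColoring δ s v unfolds to below (ρ δ (y s v)) (x s v).
below : ∀ {k} → ℚ → (Fin k → ℚ) → Subset k
below ρ x = tabulate (λ c → does (x c ℚP.<? ρ))

∉below⇒≤ : ∀ {k} ρ (x : Fin k → ℚ) {c} → c ∉ below ρ x → ρ ≤ x c
∉below⇒≤ ρ x {c} c∉ = ℚP.≮⇒≥ λ x<ρ →
  c∉ (lookup⇒[]= c _ (trans (lookup∘tabulate _ c) (dec-true (x c ℚP.<? ρ) x<ρ)))

sumℚ+∣below∣*gap≤k : ∀ {k} ρ (x : Fin k → ℚ) → (∀ c → x c ≤ 1ℚ) →
  sumℚ x + ℕ→ℚ ∣ below ρ x ∣ * (1ℚ - ρ) ≤ ℕ→ℚ k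
sumℚ+∣below∣*gap≤k {zero}  ρ x x≤1 = ℚP.≤-reflexive (trans (ℚP.+-identityˡ _) (ℚP.*-zeroˡ (1ℚ - ρ)))
sumℚ+∣below∣*gap≤k {suc k} ρ x x≤1 = by-cases (x zero ℚP.<? ρ)
  where
  open ℚP.≤-Reasoning
  x₀ = x zero
  S  = sumℚ (λ c → x (suc c))
  L  = ∣ below ρ (λ c → x (suc c)) ∣
  g  = 1ℚ - ρ
  ih : S + ℕ→ℚ L * g ≤ ℕ→ℚ k
  ih = sumℚ+∣below∣*gap≤k ρ (λ c → x (suc c)) (λ c → x≤1 (suc c))
  regroup : ∀ a s l h → a + s + (1ℚ + l) * h ≡ (a + h) + (s + l * h)
  regroup = solve-∀ ℚ-ring
  r+[1-r]≡1 : ∀ r → r + (1ℚ - r) ≡ 1ℚ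
  r+[1-r]≡1 = solve-∀ ℚ-ring
  by-cases : (x₀<?ρ : Dec (x₀ < ρ)) →
             x₀ + S + ℕ→ℚ ∣ does x₀<?ρ ∷ below ρ (λ c → x (suc c)) ∣ * g ≤ ℕ→ℚ (suc k)
  by-cases (yes x₀<ρ) = begin
    x₀ + S + ℕ→ℚ (suc L) * g    ≡⟨ cong (λ t → x₀ + S + t * g) (ℕ→ℚ-suc L) ⟩
    x₀ + S + (1ℚ + ℕ→ℚ L) * g   ≡⟨ regroup x₀ S (ℕ→ℚ L) g ⟩
    (x₀ + g) + (S + ℕ→ℚ L * g)  ≤⟨ ℚP.+-mono-≤ x₀+g≤1 ih ⟩
    1ℚ + ℕ→ℚ k                  ≡⟨ ℕ→ℚ-suc k ⟨
    ℕ→ℚ (suc k)                 ∎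
    where
    x₀+g≤1 : x₀ + g ≤ 1ℚ
    x₀+g≤1 = ℚP.≤-trans (ℚP.+-monoˡ-≤ g (ℚP.<⇒≤ x₀<ρ)) (ℚP.≤-reflexive (r+[1-r]≡1 ρ))
  by-cases (no _) = begin
    x₀ + S + ℕ→ℚ L * g    ≡⟨ ℚP.+-assoc x₀ S _ ⟩
    x₀ + (S + ℕ→ℚ L * g)  ≤⟨ ℚP.+-mono-≤ (x≤1 zero) ih ⟩
    1ℚ + ℕ→ℚ k            ≡⟨ ℕ→ℚ-suc k ⟨
    ℕ→ℚ (suc k)           ∎

∣below∣≤suc : ∀ {k δ y r} (x : Fin k → ℚ) → 0ℚ ≤ δ → 0ℚ ≤ 1ℚ - δ → y < ℕ→ℚ r + δ →
  (∀ c → x c ≤ 1ℚ) → ℕ→ℚ k - y - 1ℚ ≤ sumℚ x →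
  ∣ below ((1ℚ - δ) * 1/suc (suc r)) x ∣ ℕ.≤ suc r
∣below∣≤suc {k} {δ} {y} {r} x 0≤δ 0≤1-δ y<r+δ x≤1 cover with L ℕ.≤? suc r
  where L = ∣ below ((1ℚ - δ) * 1/suc (suc r)) x ∣
... | yes L≤1+r = L≤1+r
... | no  L≰1+r = ⊥-elim (ℚP.<-irrefl refl (ℚP.<-≤-trans y<r+δ (r+δ≤y (ℕP.≰⇒> L≰1+r))))
  where
  open ℚP.≤-Reasoning
  ρ′ = (1ℚ - δ) * 1/suc (suc r)
  g  = 1ℚ - ρ′
  L  = ∣ below ρ′ x ∣
  R  = ℕ→ℚ (suc (suc r))
  0≤g : 0ℚ ≤ g
  0≤g = p≤q⇒0≤q-p (ℚP.≤-trans (p*q≤p 0≤1-δ (1/suc-antimono (ℕ.z≤n {suc r}))) (p-q≤p {1ℚ} 0≤δ))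
  R*g≡ : R * g ≡ 1ℚ + (1ℚ + ℕ→ℚ r) - (1ℚ - δ)
  R*g≡ = begin-equality
    R * (1ℚ - (1ℚ - δ) * 1/suc (suc r))  ≡⟨ expand R (1ℚ - δ) (1/suc (suc r)) ⟩
    R - (1ℚ - δ) * (R * 1/suc (suc r))   ≡⟨ cong (λ t → R - (1ℚ - δ) * t) (ℕ→ℚ-suc*1/suc (suc r)) ⟩
    R - (1ℚ - δ) * 1ℚ                    ≡⟨ cong₂ _-_ R≡ (ℚP.*-identityʳ (1ℚ - δ)) ⟩
    1ℚ + (1ℚ + ℕ→ℚ r) - (1ℚ - δ)         ∎
    where
    R≡ = trans (ℕ→ℚ-suc (suc r)) (cong (_+_ 1ℚ) (ℕ→ℚ-suc r))
    expand : ∀ a b c → a * (1ℚ - b * c) ≡ a - b * (a * c)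
    expand = solve-∀ ℚ-ring
  r+δ≤y : suc (suc r) ℕ.≤ L → ℕ→ℚ r + δ ≤ y
  r+δ≤y 2+r≤L = begin
    ℕ→ℚ r + δ                                          ≡⟨ regroup K y (ℕ→ℚ r) δ ⟩
    (K - y - 1ℚ) + (1ℚ + (1ℚ + ℕ→ℚ r) - (1ℚ - δ)) + (y - K)
                                                       ≡⟨ cong (λ t → (K - y - 1ℚ) + t + (y - K)) R*g≡ ⟨
    (K - y - 1ℚ) + R * g + (y - K)                     ≤⟨ ℚP.+-monoˡ-≤ (y - K) (ℚP.+-mono-≤ cover R*g≤L*g) ⟩
    sumℚ x + ℕ→ℚ L * g + (y - K)                       ≤⟨ ℚP.+-monoˡ-≤ (y - K) (sumℚ+∣below∣*gap≤k ρ′ x x≤1) ⟩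
    K + (y - K)                                        ≡⟨ cancel K y ⟩
    y                                                  ∎
    where
    K = ℕ→ℚ k
    R*g≤L*g = ℚP.*-monoʳ-≤-nonNeg g {{ℚ.nonNegative 0≤g}} (ℕ→ℚ-mono-≤ 2+r≤L)
    regroup : ∀ K Y r d → r + d ≡ (K - Y - 1ℚ) + (1ℚ + (1ℚ + r) - (1ℚ - d)) + (Y - K)
    regroup = solve-∀ ℚ-ring
    cancel : ∀ K Y → K + (Y - K) ≡ Y
    cancel = solve-∀ ℚ-ring

∣below-ρ∣∸1≤y÷δ : ∀ {k δ} y (x : Fin k → ℚ) (0<δ : 0ℚ < δ) → δ ≤ 1ℚ → 0ℚ ≤ y →
  (∀ c → x c ≤ 1ℚ) → ℕ→ℚ k - y - 1ℚ ≤ sumℚ x →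
  ℕ→ℚ (∣ below (ρ δ y) x ∣ ∸ 1) ≤ divPos y δ 0<δ
∣below-ρ∣∸1≤y÷δ {δ = δ} y x 0<δ δ≤1 0≤y x≤1 cover = begin
  ℕ→ℚ (∣ below (ρ δ y) x ∣ ∸ 1)  ≤⟨ ℕ→ℚ-mono-≤ (ℕP.∸-monoˡ-≤ 1 ∣below∣≤1+r) ⟩
  ℕ→ℚ r                          ≤⟨ p*q≤r⇒p≤r*t (ℚP.*-inverseʳ δ) (ℚP.nonNegative⁻¹ (1/ δ)) (r*δ≤y bounds) ⟩
  y * 1/ δ                       ∎
  where
  open ℚP.≤-Reasoning
  open RoundδBounds
  instance
    δ≢0 : ℚ.NonZero δ
    δ≢0 = ℚP.pos⇒nonZero δ {{ℚ.positive 0<δ}}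
    1/δ≥0 : ℚ.NonNegative (1/ δ)
    1/δ≥0 = ℚP.pos⇒nonNeg (1/ δ) {{ℚP.1/pos⇒pos δ {{ℚ.positive 0<δ}}}}
  r = ℤ.∣ roundδ δ y ∣
  bounds : RoundδBounds δ y r
  bounds = roundδ-bounds 0<δ δ≤1 0≤y
  ∣below∣≤1+r : ∣ below (ρ δ y) x ∣ ℕ.≤ suc r
  ∣below∣≤1+r = ∣below∣≤suc x (ℚP.<⇒≤ 0<δ) (p≤q⇒0≤q-p δ≤1) (y<r+δ bounds) x≤1 cover

-- The LP solution induced by a coloring

sumℕ-∉+∣q∣≡k : ∀ {k} (q : Subset k) → sumℕ (λ c → indicator (¬? (c ∈? q))) ℕ.+ ∣ q ∣ ≡ k
sumℕ-∉+∣q∣≡k []            = refl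
sumℕ-∉+∣q∣≡k (inside ∷ q)  = trans (ℕP.+-suc _ ∣ q ∣) (cong suc (sumℕ-∉+∣q∣≡k q))
sumℕ-∉+∣q∣≡k (outside ∷ q) = cong suc (sumℕ-∉+∣q∣≡k q)

s+[l+1]≡k⇒k-l-1≡s : ∀ s l {k} → s ℕ.+ (l ℕ.+ 1) ≡ k → ℕ→ℚ k - ℕ→ℚ l - 1ℚ ≡ ℕ→ℚ s
s+[l+1]≡k⇒k-l-1≡s s l refl = begin
  ℕ→ℚ (s ℕ.+ (l ℕ.+ 1)) - ℕ→ℚ l - 1ℚ  ≡⟨ cong (λ t → t - ℕ→ℚ l - 1ℚ) (trans (ℕ→ℚ-+ s _) (cong (_+_ (ℕ→ℚ s)) (ℕ→ℚ-+ l 1))) ⟩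
  ℕ→ℚ s + (ℕ→ℚ l + 1ℚ) - ℕ→ℚ l - 1ℚ  ≡⟨ cancel (ℕ→ℚ s) (ℕ→ℚ l) ⟩
  ℕ→ℚ s                                ∎
  where
  open ≡-Reasoning
  cancel : ∀ a b → a + (b + 1ℚ) - b - 1ℚ ≡ a
  cancel = solve-∀ ℚ-ring

cover-by-complement : ∀ {k} (q : Subset k) → 1 ℕ.≤ ∣ q ∣ →
  ℕ→ℚ k - ℕ→ℚ (∣ q ∣ ∸ 1) - 1ℚ ≤ sumℚ (λ c → ℕ→ℚ (indicator (¬? (c ∈? q))))
cover-by-complement {k} q 1≤∣q∣ =
  ℚP.≤-reflexive (trans (s+[l+1]≡k⇒k-l-1≡s (sumℕ 𝟙∉q) (∣ q ∣ ∸ 1) s+∣q∣≡k) (ℕ→ℚ-sumℕ 𝟙∉q))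
  where
  𝟙∉q = λ c → indicator (¬? (c ∈? q))
  s+∣q∣≡k : sumℕ 𝟙∉q ℕ.+ ((∣ q ∣ ∸ 1) ℕ.+ 1) ≡ k
  s+∣q∣≡k = trans (cong (sumℕ 𝟙∉q ℕ.+_) (ℕP.m∸n+n≡m 1≤∣q∣)) (sumℕ-∉+∣q∣≡k q)

module _ {k} (H : Hypergraph k) where

  mistake? : (col : Coloring H) (e : Fin (m H)) → Dec (Mistake H col e)
  mistake? col e = any? (λ v → (v ∈? E H e) ×-dec ¬? (ℓ H e ∈? col v))

  coloringLP : Coloring H → LPSol H
  coloringLP col = record
    { x  = λ v c → ℕ→ℚ (indicator (¬? (c ∈? col v)))
    ; xe = λ e → ℕ→ℚ (indicator (mistake? col e))
    ; y  = λ v → ℕ→ℚ (∣ col v ∣ ∸ 1)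
    }

  coloringLP-feasible : ∀ {b col} → FeasibleGOECC H b col → LPFeasible H b (coloringLP col)
  coloringLP-feasible {b} {col} (1≤∣col∣ , extra≤b) =
      (λ v → cover-by-complement (col v) (1≤∣col∣ v))
    , subst (_≤ ℕ→ℚ b) (ℕ→ℚ-sumℕ (λ v → ∣ col v ∣ ∸ 1)) (ℕ→ℚ-mono-≤ extra≤b)
    , (λ { c e v refl v∈e → ℕ→ℚ-mono-≤
             (indicator-mono (¬? (c ∈? col v)) (mistake? col e) (λ ℓ∉ → v , v∈e , ℓ∉)) })
    , (λ v c → ℕ→ℚ-nonNeg (indicator (¬? (c ∈? col v))) , ℕ→ℚ-mono-≤ (indicator≤1 (¬? (c ∈? col v))))
    , (λ e → ℕ→ℚ-nonNeg (indicator (mistake? col e)) , ℕ→ℚ-mono-≤ (indicator≤1 (mistake? col e)))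
    , (λ v → ℕ→ℚ-nonNeg (∣ col v ∣ ∸ 1))

  LPObjective≤mistakes : ∀ b s col → LPOptimal H b s → FeasibleGOECC H b col →
    LPObjective s ≤ ℕ→ℚ (mistakes H col)
  LPObjective≤mistakes b s col (_ , optimal) feasible-col =
    subst (_ ≤_) (sym (ℕ→ℚ-sumℕ (λ e → indicator (mistake? col e))))
      (optimal (coloringLP col) (coloringLP-feasible feasible-col))

-- The rounded coloring

module _ {k} (H : Hypergraph k) (b : ℕ) (s : LPSol H) {δ : ℚ} (0<δ : 0ℚ < δ) (δ≤1 : δ ≤ 1ℚ)
         (budget : sumℚ (y s) ≤ ℕ→ℚ b) (0≤y : ∀ v → 0ℚ ≤ y s v) where

  extraColors-rounded≤ : (∀ v → ℕ→ℚ k - y s v - 1ℚ ≤ sumℚ (x s v)) → (∀ v c → x s v c ≤ 1ℚ) →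
    ℕ→ℚ (extraColors H (roundedColoring δ s)) ≤ divPos (ℕ→ℚ b) δ 0<δ
  extraColors-rounded≤ cover x≤1 = begin
    ℕ→ℚ (extraColors H (roundedColoring δ s))         ≡⟨ ℕ→ℚ-sumℕ (λ v → ∣ roundedColoring δ s v ∣ ∸ 1) ⟩
    sumℚ (λ v → ℕ→ℚ (∣ roundedColoring δ s v ∣ ∸ 1))  ≤⟨ sumℚ-mono-≤ extra≤y÷δ ⟩
    sumℚ (λ v → y s v * 1/ δ)                        ≡⟨ sumℚ-*ʳ (y s) (1/ δ) ⟩
    sumℚ (y s) * 1/ δ                                ≤⟨ ℚP.*-monoʳ-≤-nonNeg (1/ δ) budget ⟩
    ℕ→ℚ b * 1/ δ                                     ∎
    where
    open ℚP.≤-Reasoning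
    instance
      δ≢0 : ℚ.NonZero δ
      δ≢0 = ℚP.pos⇒nonZero δ {{ℚ.positive 0<δ}}
      1/δ≥0 : ℚ.NonNegative (1/ δ)
      1/δ≥0 = ℚP.pos⇒nonNeg (1/ δ) {{ℚP.1/pos⇒pos δ {{ℚ.positive 0<δ}}}}
    extra≤y÷δ : ∀ v → ℕ→ℚ (∣ roundedColoring δ s v ∣ ∸ 1) ≤ y s v * 1/ δ
    extra≤y÷δ v = ∣below-ρ∣∸1≤y÷δ (y s v) (x s v) 0<δ δ≤1 (0≤y v) (x≤1 v) (cover v)

  mistake⇒[1-δ]/[b+2]≤xe : (∀ c e v → ℓ H e ≡ c → v ∈ E H e → x s v c ≤ xe s e) →
    ∀ e → Mistake H (roundedColoring δ s) e → (1ℚ - δ) * 1/suc (suc b) ≤ xe s e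
  mistake⇒[1-δ]/[b+2]≤xe x≤xe e (v , v∈e , ℓ∉) = begin
    (1ℚ - δ) * 1/suc (suc b)  ≤⟨ ℚP.*-monoˡ-≤-nonNeg (1ℚ - δ) {{ℚ.nonNegative (p≤q⇒0≤q-p δ≤1)}}
                                   (1/suc-antimono (ℕ.s≤s r≤b)) ⟩
    ρ δ (y s v)               ≤⟨ ∉below⇒≤ (ρ δ (y s v)) (x s v) ℓ∉ ⟩
    x s v (ℓ H e)             ≤⟨ x≤xe (ℓ H e) e v refl v∈e ⟩
    xe s e                    ∎
    where
    open ℚP.≤-Reasoning
    r≤b : ℤ.∣ roundδ δ (y s v) ∣ ℕ.≤ b
    r≤b = RoundδBounds.r≤ (roundδ-bounds 0<δ δ≤1 (0≤y v)) (ℚP.≤-trans (f≤sumℚ 0≤y v) budget)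

module _ (b : ℕ) (δ : ℚ) (0<1-δ : 0ℚ < 1ℚ - δ) where

  private
    instance
      1-δ≢0 : ℚ.NonZero (1ℚ - δ)
      1-δ≢0 = ℚP.pos⇒nonZero (1ℚ - δ) {{ℚ.positive 0<1-δ}}
      1/[1-δ]≥0 : ℚ.NonNegative (1/ (1ℚ - δ))
      1/[1-δ]≥0 = ℚP.pos⇒nonNeg (1/ (1ℚ - δ)) {{ℚP.1/pos⇒pos (1ℚ - δ) {{ℚ.positive 0<1-δ}}}}

    b+2≡ : ℕ→ℚ b + ℕ→ℚ 2 ≡ ℕ→ℚ (suc (suc b))
    b+2≡ = trans (sym (ℕ→ℚ-+ b 2)) (cong ℕ→ℚ (ℕP.+-comm b 2))

  roundingFactor : ℚ
  roundingFactor = divPos (ℕ→ℚ b + ℕ→ℚ 2) (1ℚ - δ) 0<1-δ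

  0≤roundingFactor : 0ℚ ≤ roundingFactor
  0≤roundingFactor = subst (_≤ roundingFactor) (ℚP.*-zeroˡ (1/ (1ℚ - δ)))
    (ℚP.*-monoʳ-≤-nonNeg (1/ (1ℚ - δ)) (subst (0ℚ ≤_) (sym b+2≡) (ℕ→ℚ-nonNeg (suc (suc b)))))

  [1-δ]/[b+2]*roundingFactor≡1 : (1ℚ - δ) * 1/suc (suc b) * roundingFactor ≡ 1ℚ
  [1-δ]/[b+2]*roundingFactor≡1 = begin
    a * u * (B * 1/ a)    ≡⟨ swap a u B (1/ a) ⟩
    (B * u) * (a * 1/ a)  ≡⟨ cong₂ _*_ (trans (cong (_* u) b+2≡) (ℕ→ℚ-suc*1/suc (suc b))) (ℚP.*-inverseʳ a) ⟩
    1ℚ * 1ℚ               ≡⟨ ℚP.*-identityʳ 1ℚ ⟩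
    1ℚ                    ∎
    where
    open ≡-Reasoning
    a = 1ℚ - δ
    u = 1/suc (suc b)
    B = ℕ→ℚ b + ℕ→ℚ 2
    swap : ∀ a u B i → a * u * (B * i) ≡ (B * u) * (a * i)
    swap = solve-∀ ℚ-ring

theorem4p3 : ∀ {k} (H : Hypergraph k) (b : ℕ) (s : LPSol H) →
    LPOptimal H b s →
    (δ : ℚ) (δ>0 : 0ℚ < δ) (δ<1 : δ < 1ℚ) (1-δ>0 : 0ℚ < 1ℚ - δ) →
    ((col : Coloring H) → FeasibleGOECC H b col →
      ℕ→ℚ (mistakes H (roundedColoring δ s))
        ≤ (divPos (ℕ→ℚ b + ℕ→ℚ 2) (1ℚ - δ) 1-δ>0 + 1ℚ) * ℕ→ℚ (mistakes H col))
    × (ℕ→ℚ (extraColors H (roundedColoring δ s)) ≤ divPos (ℕ→ℚ b) δ δ>0)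
theorem4p3 H b s optimal@((cover , budget , x≤xe , x∈[0,1] , xe∈[0,1] , 0≤y) , _) δ δ>0 δ<1 1-δ>0 =
  mistakes-bound , extraColors-rounded≤ H b s δ>0 δ≤1 budget 0≤y cover (λ v c → proj₂ (x∈[0,1] v c))
  where
  open ℚP.≤-Reasoning
  δ≤1 = ℚP.<⇒≤ δ<1
  rounded = roundedColoring δ s
  θ K : ℚ
  θ = (1ℚ - δ) * 1/suc (suc b)
  K = roundingFactor b δ 1-δ>0
  mistakes*θ≤LP : ℕ→ℚ (mistakes H rounded) * θ ≤ LPObjective s
  mistakes*θ≤LP = count*≤sumℚ (mistake? H rounded) (λ e → proj₁ (xe∈[0,1] e))
                    (mistake⇒[1-δ]/[b+2]≤xe H b s δ>0 δ≤1 budget 0≤y x≤xe)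
  mistakes-bound : (col : Coloring H) → FeasibleGOECC H b col →
    ℕ→ℚ (mistakes H rounded) ≤ (K + 1ℚ) * ℕ→ℚ (mistakes H col)
  mistakes-bound col feasible-col = begin
    ℕ→ℚ (mistakes H rounded)         ≤⟨ p*q≤r⇒p≤r*t ([1-δ]/[b+2]*roundingFactor≡1 b δ 1-δ>0)
                                           (0≤roundingFactor b δ 1-δ>0)
                                           (ℚP.≤-trans mistakes*θ≤LP (LPObjective≤mistakes H b s col optimal feasible-col)) ⟩
    ℕ→ℚ (mistakes H col) * K         ≤⟨ p*q≤[q+1]*p K (ℕ→ℚ-nonNeg (mistakes H col)) ⟩
    (K + 1ℚ) * ℕ→ℚ (mistakes H col)  ∎
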